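{- Let $G=(V,E)$ be a graph and let $S,X\subseteq V$ be such that both $G-S$ and $G-X$ are 2-plex cluster graphs. Let $M\subseteq V$ and let $H$ be the vertex set of a connected component of $G-X$ such that no vertex of $H\setminus M$ has a neighbor in $X$. If $S$ does not destroy all edges in $E(H,X)$, then $S$ contains at least $|H\setminus M|-1$ vertices from $H\setminus M$.
   Context: All graphs are finite, simple and undirected. A 2-plex is a graph in which every vertex is nonadjacent to at most one other vertex; a 2-plex cluster graph is a graph each of whose connected components is a 2-plex. For $U,W\subseteq V$, $E(U,W)=\{\{u,w\}\in E: u\in U, w\in W\}$. A vertex set $S$ destroys an edge $e$ if $S$ contains an endpoint of $e$. -}

module Defs where

open import Data.Nat using (ℕ)
open import Data.Fin using (Fin)
open import Data.Fin.Subset using (Subset; _∈_; _∉_; ∁)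
open import Data.Product using (Σ; ∃; _×_)
open import Data.Sum using (_⊎_)
open import Relation.Nullary using (¬_)
open import Relation.Binary.PropositionalEquality using (_≡_; _≢_)
open import Relation.Binary.Definitions using (Decidable)
open import Function.Bundles using (_⇔_)

record Graph (n : ℕ) : Set₁ where
  field
    Adj     : Fin n → Fin n → Set
    adj?    : Decidable Adj
    sym     : ∀ {u v} → Adj u v → Adj v u
    irrefl  : ∀ {u} → ¬ Adj u u
open Graph public

module _ {n : ℕ} (G : Graph n) where

  data Reach (U : Subset n) (u : Fin n) : Fin n → Set where
    here : u ∈ U → Reach U u u
    step : ∀ {w v} → Reach U u w → Adj G w v → v ∈ U → Reach U u v

  IsComponent : Subset n → Subset n → Set
  IsComponent U C =
    (∃ λ u → u ∈ C) × (∀ u v → u ∈ C → (v ∈ C ⇔ Reach U u v))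

  Is2Plex : Subset n → Set
  Is2Plex C = ∀ u v w → u ∈ C → v ∈ C → w ∈ C →
    u ≢ v → u ≢ w → ¬ Adj G u v → ¬ Adj G u w → v ≡ w

  Is2PlexCluster : Subset n → Set
  Is2PlexCluster U = ∀ C → IsComponent U C → Is2Plex C

  Minus2PlexCluster : Subset n → Set
  Minus2PlexCluster S = Is2PlexCluster (∁ S)

  DestroysAll : Subset n → Subset n → Subset n → Set
  DestroysAll S A B = ∀ a b → a ∈ A → b ∈ B → Adj G a b → a ∈ S ⊎ b ∈ S

-- Let H be a component of the 2-plex cluster graph G - X whose vertices
-- outside M have no neighbour in X, and let {h, x} ∈ E(H, X) survive S.
-- Then h ∈ M, and any two distinct survivors v, w ∈ (H ∖ M) ∖ S are
-- reached from x in G - S: by the 2-plex property of H, h is adjacent to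
-- v or w, and any one of them not adjacent to h is adjacent to the other.
-- So x, v, w share a component of the 2-plex cluster graph G - S, where
-- x misses both v and w (they have no neighbour in X); the 2-plex
-- property forces v = w.  Hence at most one vertex of H ∖ M avoids S,
-- which is the counting bound  ∣ S ∩ (H ∖ M) ∣ ≥ ∣ H ∖ M ∣ - 1.
module Submission where

open import Defs
open import Data.Nat using (ℕ; zero; suc; _+_; _≤_; _≥_; _∸_; z≤n)
open import Data.Nat.Properties using (+-suc; ≤-reflexive; ≤-trans; +-monoˡ-≤; m≤n+o⇒m∸n≤o)
open import Data.Fin using (Fin; zero; suc; _≟_)
open import Data.Fin.Subset using (Subset; _∈_; _∉_; _∩_; _─_; ∁; ∣_∣; ⁅_⁆; _⊆_; outside; inside)
open import Data.Fin.Subset.Properties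
  using (_∈?_; nonempty?; Empty-unique; ∣⊥∣≡0; ∣⁅x⁆∣≡1; p⊆q⇒∣p∣≤∣q∣; x∈⁅y⁆⇔x≡y;
         p─q⊆p; x∈∁p⇒x∉p; x∉p⇒x∈∁p)
open import Data.Vec using (_∷_; []; tabulate; here; there)
open import Data.Vec.Properties using ([]=⇒lookup; lookup⇒[]=; lookup∘tabulate)
open import Data.Product using (_×_; _,_; proj₂)
open import Data.Sum using (_⊎_; inj₁; inj₂)
open import Data.Empty using (⊥-elim)
open import Function using (_∘_)
open import Function.Bundles using (_⇔_; mk⇔; Equivalence)
open import Relation.Nullary using (¬_; Dec; yes; no; does)
open import Relation.Nullary.Decidable using (dec-true; decidable-stable; ¬¬-excluded-middle)
open import Relation.Nullary.Negation using (¬¬-map)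
open import Relation.Binary.PropositionalEquality
  using (_≡_; _≢_; refl; trans; cong; subst) renaming (sym to ≡-sym)

∣p∣≡∣p─q∣+∣q∩p∣ : ∀ {n} (p q : Subset n) → ∣ p ∣ ≡ ∣ p ─ q ∣ + ∣ q ∩ p ∣
∣p∣≡∣p─q∣+∣q∩p∣ []            []            = refl
∣p∣≡∣p─q∣+∣q∩p∣ (inside  ∷ p) (inside  ∷ q) =
  trans (cong suc (∣p∣≡∣p─q∣+∣q∩p∣ p q)) (≡-sym (+-suc ∣ p ─ q ∣ ∣ q ∩ p ∣))
∣p∣≡∣p─q∣+∣q∩p∣ (inside  ∷ p) (outside ∷ q) = cong suc (∣p∣≡∣p─q∣+∣q∩p∣ p q)
∣p∣≡∣p─q∣+∣q∩p∣ (outside ∷ p) (inside  ∷ q) = ∣p∣≡∣p─q∣+∣q∩p∣ p q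
∣p∣≡∣p─q∣+∣q∩p∣ (outside ∷ p) (outside ∷ q) = ∣p∣≡∣p─q∣+∣q∩p∣ p q

x∈p─q⇒x∉q : ∀ {n} (p q : Subset n) {x : Fin n} → x ∈ p ─ q → x ∉ q
x∈p─q⇒x∉q (inside ∷ p) (outside ∷ q) here        ()
x∈p─q⇒x∉q (_      ∷ p) (_       ∷ q) (there x∈) (there x∈q) = x∈p─q⇒x∉q p q x∈ x∈q

subsingleton⇒∣p∣≤1 : ∀ {n} (p : Subset n) → (∀ v w → v ∈ p → w ∈ p → v ≡ w) → ∣ p ∣ ≤ 1
subsingleton⇒∣p∣≤1 {n} p all≡ with nonempty? p
... | yes (v , v∈p) = subst (∣ p ∣ ≤_) (∣⁅x⁆∣≡1 v) (p⊆q⇒∣p∣≤∣q∣ p⊆⁅v⁆)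
  where
    p⊆⁅v⁆ : p ⊆ ⁅ v ⁆
    p⊆⁅v⁆ {w} w∈p = Equivalence.from x∈⁅y⁆⇔x≡y (all≡ w v w∈p v∈p)
... | no p-empty = subst (_≤ 1) (≡-sym (trans (cong ∣_∣ (Empty-unique p-empty)) (∣⊥∣≡0 n))) z≤n

atMostOneOutside⇒bound : ∀ {n} (A S : Subset n) →
  (∀ v w → v ∈ A → v ∉ S → w ∈ A → w ∉ S → v ≡ w) → ∣ S ∩ A ∣ ≥ ∣ A ∣ ∸ 1
atMostOneOutside⇒bound A S unique = m≤n+o⇒m∸n≤o ∣ A ∣ 1 split
  where
    outside≤1 : ∣ A ─ S ∣ ≤ 1
    outside≤1 = subsingleton⇒∣p∣≤1 (A ─ S) λ v w v∈ w∈ →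
      unique v w (p─q⊆p A S v∈) (x∈p─q⇒x∉q A S v∈) (p─q⊆p A S w∈) (x∈p─q⇒x∉q A S w∈)
    split : ∣ A ∣ ≤ 1 + ∣ S ∩ A ∣
    split = ≤-trans (≤-reflexive (∣p∣≡∣p─q∣+∣q∩p∣ A S)) (+-monoˡ-≤ ∣ S ∩ A ∣ outside≤1)

subsetOf : ∀ {n} {P : Fin n → Set} → (∀ y → Dec (P y)) → Subset n
subsetOf P? = tabulate (does ∘ P?)

∈subsetOf⇔ : ∀ {n} {P : Fin n → Set} (P? : ∀ y → Dec (P y)) {y : Fin n} →
  y ∈ subsetOf P? ⇔ P y
∈subsetOf⇔ {P = P} P? {y} = mk⇔ to from
  where
    to : y ∈ subsetOf P? → P y
    to y∈ with P? y | trans (≡-sym (lookup∘tabulate (does ∘ P?) y)) ([]=⇒lookup y∈)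
    ... | yes Py | _  = Py
    ... | no _   | ()
    from : P y → y ∈ subsetOf P?
    from Py = lookup⇒[]= y _ (trans (lookup∘tabulate (does ∘ P?) y) (dec-true (P? y) Py))

¬¬-decidable : ∀ n (P : Fin n → Set) → ¬ ¬ (∀ y → Dec (P y))
¬¬-decidable zero    P k = k λ ()
¬¬-decidable (suc n) P k = ¬¬-excluded-middle λ P₀? →
  ¬¬-decidable n (P ∘ suc) λ Pₛ? → k λ { zero → P₀? ; (suc y) → Pₛ? y }

module _ {n : ℕ} (G : Graph n) where

  reachEnd : ∀ {U u v} → Reach G U u v → v ∈ U
  reachEnd (here v∈U)     = v∈U
  reachEnd (step _ _ v∈U) = v∈U

  reachStart : ∀ {U u v} → Reach G U u v → u ∈ U
  reachStart (here u∈U)   = u∈U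
  reachStart (step r _ _) = reachStart r

  reachTrans : ∀ {U a b c} → Reach G U a b → Reach G U b c → Reach G U a c
  reachTrans r (here _)     = r
  reachTrans r (step s e p) = step (reachTrans r s) e p

  reachSym : ∀ {U a b} → Reach G U a b → Reach G U b a
  reachSym (here p)     = here p
  reachSym (step r e p) = reachTrans (step (here p) (Graph.sym G e) (reachEnd r)) (reachSym r)

  componentOf : ∀ U x → x ∈ U → (R? : ∀ y → Dec (Reach G U x y)) →
    IsComponent G U (subsetOf R?)
  componentOf U x x∈U R? = (x , from (here x∈U)) , λ u v u∈C →
    mk⇔ (λ v∈C → reachTrans (reachSym (to u∈C)) (to v∈C))
        (λ u⇝v → from (reachTrans (to u∈C) u⇝v))
    where
      to : ∀ {y} → y ∈ subsetOf R? → Reach G U x y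
      to = Equivalence.to (∈subsetOf⇔ R?)
      from : ∀ {y} → Reach G U x y → y ∈ subsetOf R?
      from = Equivalence.from (∈subsetOf⇔ R?)

  -- The
  -- component is only available under double negation, which suffices
  -- because equality of vertices is decidable.
  clusterNonNeighbours : ∀ {U x v w} → Is2PlexCluster G U →
    Reach G U x v → Reach G U x w → x ≢ v → x ≢ w →
    ¬ Adj G x v → ¬ Adj G x w → v ≡ w
  clusterNonNeighbours {U} {x} {v} {w} cluster x⇝v x⇝w x≢v x≢w ¬xv ¬xw =
    decidable-stable (v ≟ w) (¬¬-map viaComponent (¬¬-decidable n (Reach G U x)))
    where
      viaComponent : (∀ y → Dec (Reach G U x y)) → v ≡ w
      viaComponent R? =
        cluster C isC x v w (inC (here (reachStart x⇝v))) (inC x⇝v) (inC x⇝w) x≢v x≢w ¬xv ¬xw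
        where
          C : Subset n
          C = subsetOf R?
          isC : IsComponent G U C
          isC = componentOf U x (reachStart x⇝v) R?
          inC : ∀ {y} → Reach G U x y → y ∈ C
          inC = Equivalence.from (∈subsetOf⇔ R?)

  twoPlexTwoSteps : ∀ {C h a b} → Is2Plex G C → h ∈ C → a ∈ C → b ∈ C →
    h ≢ a → h ≢ b → a ≢ b → Adj G h a ⊎ (Adj G h b × Adj G b a)
  twoPlexTwoSteps {h = h} {a} {b} plex h∈ a∈ b∈ h≢a h≢b a≢b with adj? G h a
  ... | yes ha = inj₁ ha
  ... | no ¬ha with adj? G h b
  ...   | no ¬hb = ⊥-elim (a≢b (plex h a b h∈ a∈ b∈ h≢a h≢b ¬ha ¬hb))
  ...   | yes hb with adj? G a b
  ...     | yes ab = inj₂ (hb , Graph.sym G ab)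
  ...     | no ¬ab = ⊥-elim (h≢b (plex a h b a∈ h∈ b∈ (h≢a ∘ ≡-sym) a≢b (¬ha ∘ Graph.sym G) ¬ab))

  survivingEdge⇒atMostOneSurvivor : (S X M H : Subset n) →
    Minus2PlexCluster G S → Minus2PlexCluster G X → IsComponent G (∁ X) H →
    (∀ h x → h ∈ H ─ M → x ∈ X → ¬ Adj G h x) →
    ∀ {h x} → h ∈ H → x ∈ X → Adj G h x → h ∉ S → x ∉ S →
    ∀ {v w} → v ∈ H ─ M → v ∉ S → w ∈ H ─ M → w ∉ S → v ≡ w
  survivingEdge⇒atMostOneSurvivor S X M H clusterS clusterX compH isolated
      {h} {x} h∈H x∈X hx h∉S x∉S {v} {w} v∈ v∉S w∈ w∉S =
    decidable-stable (v ≟ w) λ v≢w →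
      v≢w (clusterNonNeighbours clusterS (x⇝ v∈ v∉S w∈ w∉S v≢w) (x⇝ w∈ w∉S v∈ v∉S (v≢w ∘ ≡-sym))
             (x≢ v∈) (x≢ w∈) (¬x~ v∈) (¬x~ w∈))
    where
      inH : ∀ {y} → y ∈ H ─ M → y ∈ H
      inH = p─q⊆p H M
      -- h has a neighbour in X, so h ∈ M and h differs from every vertex of H ∖ M.
      h≢ : ∀ {y} → y ∈ H ─ M → h ≢ y
      h≢ y∈ refl = isolated h x y∈ x∈X hx
      -- x ∈ X while H ⊆ V ∖ X.
      x≢ : ∀ {y} → y ∈ H ─ M → x ≢ y
      x≢ y∈ refl = x∈∁p⇒x∉p (reachEnd (Equivalence.to (proj₂ compH h x h∈H) (inH y∈))) x∈X
      ¬x~ : ∀ {y} → y ∈ H ─ M → ¬ Adj G x y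
      ¬x~ y∈ xy = isolated _ x y∈ x∈X (Graph.sym G xy)
      x⇝h : Reach G (∁ S) x h
      x⇝h = step (here (x∉p⇒x∈∁p x∉S)) (Graph.sym G hx) (x∉p⇒x∈∁p h∉S)
      x⇝ : ∀ {a b} → a ∈ H ─ M → a ∉ S → b ∈ H ─ M → b ∉ S → a ≢ b → Reach G (∁ S) x a
      x⇝ a∈ a∉S b∈ b∉S a≢b
        with twoPlexTwoSteps (clusterX H compH) h∈H (inH a∈) (inH b∈) (h≢ a∈) (h≢ b∈) a≢b
      ... | inj₁ ha        = step x⇝h ha (x∉p⇒x∈∁p a∉S)
      ... | inj₂ (hb , ba) = step (step x⇝h hb (x∉p⇒x∈∁p b∉S)) ba (x∉p⇒x∈∁p a∉S)

mainTheorem11 : ∀ {n : ℕ} (G : Graph n) (S X M H : Subset n) →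
    Minus2PlexCluster G S →
    Minus2PlexCluster G X →
    IsComponent G (∁ X) H →
    (∀ h x → h ∈ H ─ M → x ∈ X → ¬ Adj G h x) →
    ¬ DestroysAll G S H X →
    ∣ S ∩ (H ─ M) ∣ ≥ ∣ H ─ M ∣ ∸ 1
mainTheorem11 G S X M H clusterS clusterX compH isolated notDestroyed =
  atMostOneOutside⇒bound (H ─ M) S survivorsEqual
  where
    survivorsEqual : ∀ v w → v ∈ H ─ M → v ∉ S → w ∈ H ─ M → w ∉ S → v ≡ w
    survivorsEqual v w v∈ v∉S w∈ w∉S = decidable-stable (v ≟ w) λ v≢w → notDestroyed (destroys v≢w)
      where
        destroys : v ≢ w → DestroysAll G S H X
        destroys v≢w h x h∈H x∈X hx with h ∈? S | x ∈? S
        ... | yes h∈S | _       = inj₁ h∈S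
        ... | no _    | yes x∈S = inj₂ x∈S
        ... | no h∉S  | no x∉S  = ⊥-elim (v≢w (survivingEdge⇒atMostOneSurvivor G S X M H
                                     clusterS clusterX compH isolated h∈H x∈X hx h∉S x∉S v∈ v∉S w∈ w∉S))
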